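{- Let $k\geq 2$ and $n\geq 0$ be integers. Then \[ \left|\mathcal{O}_{1,k}(n)\right|=\frac{1}{k-1}\left(\sum_{\lambda\in\mathcal{O}_k(n)}\ell(\lambda)-\sum_{\lambda\in\mathcal{D}_k(n)}\ell(\lambda)\right). \]
   Context: A partition of $n$ is a finite nonincreasing sequence of positive integers (its parts) summing to $n$; $\ell(\lambda)$ denotes the number of parts of $\lambda$ counted with multiplicity. For an integer $k\geq 1$: $\mathcal{O}_k(n)$ is the set of partitions of $n$ with no part divisible by $k$; $\mathcal{D}_k(n)$ is the set of partitions of $n$ in which no part occurs $k$ or more times; $\mathcal{O}_{1,k}(n)$ is the set of partitions of $n$ having exactly one distinct part value divisible by $k$ (this part may be repeated any number of times), all other parts being not divisible by $k$. -}

module Defs where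

open import Data.Nat using (ℕ; _<_; _≥_; _≟_)
open import Data.Nat.Divisibility using (_∣_)
open import Data.List using (List; length; filter)
open import Data.Nat.ListAction using (sum)
open import Data.List.Relation.Unary.All using (All)
open import Data.List.Relation.Unary.Linked using (Linked)
open import Data.List.Relation.Unary.Unique.Propositional using (Unique)
open import Data.List.Membership.Propositional using (_∈_)
open import Data.Product using (_×_; ∃)
open import Function.Bundles using (_⇔_)
open import Relation.Binary.PropositionalEquality using (_≡_)
open import Relation.Nullary using (¬_)

-- A partition of n: a finite nonincreasing list of positive integers summing to n.
-- ℓ(λ) is `length λ` (number of parts with multiplicity).
IsPartition : ℕ → List ℕ → Set
IsPartition n xs = Linked _≥_ xs × All (0 <_) xs × sum xs ≡ n

multiplicity : ℕ → List ℕ → ℕ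
multiplicity p xs = length (filter (_≟ p) xs)

InO : ℕ → ℕ → List ℕ → Set
InO k n xs = IsPartition n xs × All (λ p → ¬ (k ∣ p)) xs

InD : ℕ → ℕ → List ℕ → Set
InD k n xs = IsPartition n xs × (∀ p → multiplicity p xs < k)

InO1 : ℕ → ℕ → List ℕ → Set
InO1 k n xs = IsPartition n xs ×
  ∃ (λ d → k ∣ d × d ∈ xs × (∀ p → p ∈ xs → k ∣ p → p ≡ d))

Enumerates : List (List ℕ) → (List ℕ → Set) → Set
Enumerates L P = Unique L × (∀ xs → (xs ∈ L) ⇔ P xs)

module Submission where

-- Splitting every part b * k ^ i (with k ∤ b) into k ^ i parts b maps every partition of n to one in
-- 𝒪_k(n); we count the fibres above λ ∈ 𝒪_k(n), in which b occurs f_b times. The fibre in 𝒟_k(n) is a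
-- single partition (Glaisher): it contains b * k ^ t as often as the t-th base-k digit of f_b, so its
-- length is Σ_b s_k(f_b). The fibre in 𝒪_{1,k}(n) consists of the partitions obtained by merging
-- j * k ^ a copies of one b (a, j ≥ 1, j * k ^ a ≤ f_b) into j parts b * k ^ a, so it has
-- Σ_b Σ_{a ≥ 1} ⌊f_b / k ^ a⌋ elements. Legendre's f = s_k(f) + (k - 1) Σ_{a ≥ 1} ⌊f / k ^ a⌋ thus gives
-- ℓ(λ) = ℓ(λ_𝒟) + (k - 1) |fibre in 𝒪_{1,k}(n)|, and summing over λ ∈ 𝒪_k(n) proves the identity.

module Glaisher where

  open import Defs
  open import Data.Nat
    using (ℕ; zero; suc; pred; _+_; _*_; _∸_; _^_; _≤_; _<_; _≥_; z≤n; s≤s; _≟_; _/_; _%_)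
  open import Data.Nat.Properties
  open import Data.Nat.DivMod
  open import Data.Nat.Divisibility using (_∣_; n∣m⇒m%n≡0; m%n≡0⇒n∣m; n∣m*n)
  open import Data.Nat.ListAction using (sum)
  open import Data.Nat.ListAction.Properties using (sum-++; sum-↭)
  open import Data.Nat.Tactic.RingSolver using (solve-∀)
  open import Data.List
    using (List; []; _∷_; _++_; [_]; length; map; filter; replicate; concatMap; deduplicate; upTo)
  open import Data.List.Properties
    using ( map-replicate; map-cong; map-∘; map-++; map-id; filter-accept; filter-reject; filter-all
          ; filter-none; length-replicate; length-++; length-map; concatMap-cong; concatMap-map
          ; concatMap-++; ++-assoc; ≡-dec; partition-defn; filter-++; filter-some; length-upTo)
  open import Data.List.Relation.Unary.All as All using (All; []; _∷_)
  import Data.List.Relation.Unary.All.Properties as All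
  open import Data.List.Relation.Unary.Any as Any using (here; there)
  open import Data.List.Relation.Unary.Linked using (Linked)
  open import Data.List.Relation.Unary.Unique.Propositional using (Unique)
  open import Data.List.Relation.Unary.AllPairs using ([]; _∷_)
  import Data.List.Relation.Unary.Unique.Propositional.Properties as Unique
  import Data.List.Relation.Unary.Unique.DecPropositional.Properties as Unique
  open import Data.List.Membership.Propositional using (_∈_; _∉_)
  open import Data.List.Membership.Propositional.Properties
    using (∈-++⁺ˡ; ∈-++⁺ʳ; ∈-++⁻; ∈-map⁺; ∈-map⁻; ∈-filter⁺; ∈-filter⁻; ∈-deduplicate⁺; ∈-deduplicate⁻; ∈-upTo⁺; ∈-upTo⁻)
  open import Data.List.Membership.Propositional.Properties.WithK using (unique∧set⇒bag)
  import Data.List.Membership.DecPropositional as DecMembership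
  open import Data.List.Relation.Binary.BagAndSetEquality using (∼bag⇒↭)
  open import Data.List.Relation.Binary.Permutation.Propositional
    using (_↭_; ↭-refl; ↭-sym; ↭-trans; ↭-prep; ↭⇒↭ₛ; ↭ₛ⇒↭; ↭-reflexive; module PermutationReasoning)
  import Data.List.Relation.Binary.Permutation.Propositional as Perm
  open import Data.List.Relation.Binary.Permutation.Propositional.Properties
    using (++⁺; ++⁺ˡ; shift; shifts; ∈-resp-↭; ↭-length; filter-↭) renaming (map⁺ to map-↭)
  import Data.List.Relation.Binary.Permutation.Setoid.Properties as PermSetoid
  open import Data.List.Relation.Unary.Sorted.TotalOrder.Properties using (↗↭↗⇒≋)
  open import Data.List.Relation.Binary.Pointwise using (Pointwise-≡⇒≡)
  import Data.List.Relation.Binary.Sublist.Propositional.Properties as Sublist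
  import Data.List.Sort.InsertionSort as InsertionSort
  import Data.List.Sort.InsertionSort.Properties as InsertionSortProperties
  import Relation.Binary.Construct.Flip.EqAndOrd as Flip
  open import Relation.Binary.Bundles using (DecTotalOrder)
  open import Relation.Binary.Definitions using (DecidableEquality)
  open import Relation.Binary.PropositionalEquality
    using (_≡_; _≢_; refl; sym; trans; cong; cong₂; subst; setoid; module ≡-Reasoning)
  open import Relation.Unary using (Decidable)
  open import Relation.Unary.Properties using (∁?)
  open import Relation.Nullary using (¬_; yes; no; ¬?)
  open import Data.Product using (Σ; _×_; _,_; proj₁; proj₂; map₂)
  open import Data.Product.Properties using (,-injectiveʳ)
  open import Data.Sum using (_⊎_; inj₁; inj₂; [_,_]′)
  open import Data.Empty using (⊥-elim)
  open import Function using (id; _∘_; mk⇔; Equivalence)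

  private
    variable
      A B C : Set

  ≥-decTotalOrder : DecTotalOrder _ _ _
  ≥-decTotalOrder = Flip.decTotalOrder ≤-decTotalOrder

  open InsertionSort ≥-decTotalOrder using (sort)
  open InsertionSortProperties ≥-decTotalOrder using (sort-↭; sort-↗)

  nonincreasing-↭⇒≡ : ∀ {xs ys : List ℕ} → Linked _≥_ xs → Linked _≥_ ys → xs ↭ ys → xs ≡ ys
  nonincreasing-↭⇒≡ xs↘ ys↘ xs↭ys =
    Pointwise-≡⇒≡ (↗↭↗⇒≋ (DecTotalOrder.totalOrder ≥-decTotalOrder) xs↘ ys↘ (↭⇒↭ₛ xs↭ys))

  unique-same-members⇒↭ : ∀ {xs ys : List A} → Unique xs → Unique ys →
    (∀ {x} → x ∈ xs → x ∈ ys) → (∀ {x} → x ∈ ys → x ∈ xs) → xs ↭ ys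
  unique-same-members⇒↭ xs! ys! ⊆ ⊇ = ∼bag⇒↭ (unique∧set⇒bag xs! ys! (mk⇔ ⊆ ⊇))

  concatMap-↭ : (f : A → List B) {xs ys : List A} → xs ↭ ys → concatMap f xs ↭ concatMap f ys
  concatMap-↭ f Perm.refl          = ↭-refl
  concatMap-↭ f (Perm.prep x p)    = ++⁺ˡ (f x) (concatMap-↭ f p)
  concatMap-↭ f (Perm.swap x y p)  = ↭-trans (shifts (f x) (f y)) (++⁺ˡ (f y) (++⁺ˡ (f x) (concatMap-↭ f p)))
  concatMap-↭ f (Perm.trans p q)   = ↭-trans (concatMap-↭ f p) (concatMap-↭ f q)

  concatMap-↭-pointwise : (f g : A → List B) (xs : List A) → (∀ {x} → x ∈ xs → f x ↭ g x) →
    concatMap f xs ↭ concatMap g xs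
  concatMap-↭-pointwise f g []       f↭g = ↭-refl
  concatMap-↭-pointwise f g (x ∷ xs) f↭g = ++⁺ (f↭g (here refl)) (concatMap-↭-pointwise f g xs (f↭g ∘ there))

  ∈-concatMap⁻ : (f : A → List B) (xs : List A) {y : B} → y ∈ concatMap f xs → Σ A λ x → x ∈ xs × y ∈ f x
  ∈-concatMap⁻ f (x ∷ xs) y∈ with ∈-++⁻ (f x) y∈
  ... | inj₁ y∈fx = x , here refl , y∈fx
  ... | inj₂ y∈rest with ∈-concatMap⁻ f xs y∈rest
  ...   | x′ , x′∈ , y∈fx′ = x′ , there x′∈ , y∈fx′

  ∈-concatMap⁺ : (f : A → List B) {xs : List A} {x : A} {y : B} → x ∈ xs → y ∈ f x → y ∈ concatMap f xs
  ∈-concatMap⁺ f {_ ∷ _}  (here refl) y∈ = ∈-++⁺ˡ y∈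
  ∈-concatMap⁺ f {x ∷ _}  (there x∈)  y∈ = ∈-++⁺ʳ (f x) (∈-concatMap⁺ f x∈ y∈)

  concatMap-concatMap : (g : B → List C) (f : A → List B) (xs : List A) →
    concatMap g (concatMap f xs) ≡ concatMap (concatMap g ∘ f) xs
  concatMap-concatMap g f []       = refl
  concatMap-concatMap g f (x ∷ xs) =
    trans (concatMap-++ g (f x) (concatMap f xs)) (cong (concatMap g (f x) ++_) (concatMap-concatMap g f xs))

  replicate-++ : ∀ m n (x : A) → replicate m x ++ replicate n x ≡ replicate (m + n) x
  replicate-++ zero    n x = refl
  replicate-++ (suc m) n x = cong (x ∷_) (replicate-++ m n x)

  concatMap-replicate : (g : A → ℕ) (y : B) (xs : List A) →
    concatMap (λ x → replicate (g x) y) xs ≡ replicate (sum (map g xs)) y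
  concatMap-replicate g y []       = refl
  concatMap-replicate g y (x ∷ xs) =
    trans (cong (replicate (g x) y ++_) (concatMap-replicate g y xs)) (replicate-++ (g x) _ y)

  ∈-replicate⁻ : ∀ n {x y : A} → y ∈ replicate n x → y ≡ x
  ∈-replicate⁻ (suc n) (here y≡x) = y≡x
  ∈-replicate⁻ (suc n) (there y∈) = ∈-replicate⁻ n y∈

  ∈-replicate⁺ : ∀ n {x : A} → 0 < n → x ∈ replicate n x
  ∈-replicate⁺ (suc n) _ = here refl

  sum-replicate : ∀ m n → sum (replicate m n) ≡ m * n
  sum-replicate zero    n = refl
  sum-replicate (suc m) n = cong (n +_) (sum-replicate m n)

  length-concatMap : (f : A → List B) (xs : List A) → length (concatMap f xs) ≡ sum (map (length ∘ f) xs)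
  length-concatMap f []       = refl
  length-concatMap f (x ∷ xs) = trans (length-++ (f x)) (cong (length (f x) +_) (length-concatMap f xs))

  sum-map-concatMap : (w : B → ℕ) (f : A → List B) (xs : List A) →
    sum (map w (concatMap f xs)) ≡ sum (map (sum ∘ map w ∘ f) xs)
  sum-map-concatMap w f []       = refl
  sum-map-concatMap w f (x ∷ xs) = begin
    sum (map w (f x ++ concatMap f xs))               ≡⟨ cong sum (map-++ w (f x) (concatMap f xs)) ⟩
    sum (map w (f x) ++ map w (concatMap f xs))        ≡⟨ sum-++ (map w (f x)) _ ⟩
    sum (map w (f x)) + sum (map w (concatMap f xs))   ≡⟨ cong (sum (map w (f x)) +_) (sum-map-concatMap w f xs) ⟩
    sum (map w (f x)) + sum (map (sum ∘ map w ∘ f) xs) ∎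
    where open ≡-Reasoning

  sum-map-↭ : (w : A → ℕ) {xs ys : List A} → xs ↭ ys → sum (map w xs) ≡ sum (map w ys)
  sum-map-↭ w xs↭ys = sum-↭ (map-↭ w xs↭ys)

  sum-map-cong-∈ : (f g : A → ℕ) (xs : List A) → (∀ {x} → x ∈ xs → f x ≡ g x) → sum (map f xs) ≡ sum (map g xs)
  sum-map-cong-∈ f g []       f≡g = refl
  sum-map-cong-∈ f g (x ∷ xs) f≡g = cong₂ _+_ (f≡g (here refl)) (sum-map-cong-∈ f g xs (f≡g ∘ there))

  sum-map-+ : (f g : A → ℕ) (xs : List A) → sum (map (λ x → f x + g x) xs) ≡ sum (map f xs) + sum (map g xs)
  sum-map-+ f g []       = refl
  sum-map-+ f g (x ∷ xs) =
    trans (cong (f x + g x +_) (sum-map-+ f g xs)) (+-interchange (f x) (g x) (sum (map f xs)) _)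
    where
    +-interchange : ∀ a b c d → a + b + (c + d) ≡ a + c + (b + d)
    +-interchange = solve-∀

  sum-map-*ˡ : (c : ℕ) (f : A → ℕ) (xs : List A) → sum (map (λ x → c * f x) xs) ≡ c * sum (map f xs)
  sum-map-*ˡ c f []       = sym (*-zeroʳ c)
  sum-map-*ˡ c f (x ∷ xs) = trans (cong (c * f x +_) (sum-map-*ˡ c f xs)) (sym (*-distribˡ-+ c (f x) _))

  sum-map-≡0 : (f : A → ℕ) (xs : List A) → (∀ {x} → x ∈ xs → f x ≡ 0) → sum (map f xs) ≡ 0
  sum-map-≡0 f []       _    = refl
  sum-map-≡0 f (x ∷ xs) f≡0 = cong₂ _+_ (f≡0 (here refl)) (sum-map-≡0 f xs (f≡0 ∘ there))

  sum-map-≤-single-support : (f : ℕ → ℕ) (xs : List ℕ) (x₀ : ℕ) → Unique xs →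
    (∀ {x} → x ∈ xs → x ≢ x₀ → f x ≡ 0) → sum (map f xs) ≤ f x₀
  sum-map-≤-single-support f []       x₀ _           _    = z≤n
  sum-map-≤-single-support f (x ∷ xs) x₀ (x∉xs ∷ xs!) supp with x ≟ x₀
  ... | yes refl = ≤-reflexive (trans (cong (f x +_) (sum-map-≡0 f xs rest≡0)) (+-identityʳ (f x)))
    where
    rest≡0 : ∀ {y} → y ∈ xs → f y ≡ 0
    rest≡0 y∈ = supp (there y∈) (λ y≡x → All.lookup x∉xs y∈ (sym y≡x))
  ... | no x≢x₀ = subst (_≤ f x₀) (cong (_+ sum (map f xs)) (sym (supp (here refl) x≢x₀)))
                    (sum-map-≤-single-support f xs x₀ xs! (supp ∘ there))

  filter-∁-↭ : {P : A → Set} (P? : Decidable P) (xs : List A) → xs ↭ filter P? xs ++ filter (∁? P?) xs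
  filter-∁-↭ P? xs = subst (λ (ys , zs) → xs ↭ ys ++ zs) (partition-defn P? xs)
    (↭ₛ⇒↭ (PermSetoid.partition-↭ (setoid _) P? xs))

  filter-disjoint-union-↭ : {P Q S : A → Set} (P? : Decidable P) (Q? : Decidable Q) (S? : Decidable S) →
    (∀ {x} → S x → P x ⊎ Q x) → (∀ {x} → P x → S x) → (∀ {x} → Q x → S x) → (∀ {x} → P x → ¬ Q x) →
    (xs : List A) → filter P? xs ++ filter Q? xs ↭ filter S? xs
  filter-disjoint-union-↭ P? Q? S? S⇒P⊎Q P⇒S Q⇒S P⇒¬Q [] = ↭-refl
  filter-disjoint-union-↭ P? Q? S? S⇒P⊎Q P⇒S Q⇒S P⇒¬Q (x ∷ xs) with P? x | Q? x | S? x
  ... | yes p  | yes q  | _      = ⊥-elim (P⇒¬Q p q)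
  ... | yes p  | no _   | yes _  = ↭-prep x rest
    where rest = filter-disjoint-union-↭ P? Q? S? S⇒P⊎Q P⇒S Q⇒S P⇒¬Q xs
  ... | yes p  | no _   | no ¬s  = ⊥-elim (¬s (P⇒S p))
  ... | no _   | yes q  | yes _  = ↭-trans (shift x (filter P? xs) (filter Q? xs)) (↭-prep x rest)
    where rest = filter-disjoint-union-↭ P? Q? S? S⇒P⊎Q P⇒S Q⇒S P⇒¬Q xs
  ... | no _   | yes q  | no ¬s  = ⊥-elim (¬s (Q⇒S q))
  ... | no ¬p  | no ¬q  | yes s  = ⊥-elim ([ ¬p , ¬q ]′ (S⇒P⊎Q s))
  ... | no _   | no _   | no _   = filter-disjoint-union-↭ P? Q? S? S⇒P⊎Q P⇒S Q⇒S P⇒¬Q xs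

  module Fibres (g : A → B) (_≟B_ : DecidableEquality B) where
    open DecMembership _≟B_ using (_∈?_)

    fibre : List A → B → List A
    fibre xs y = filter (λ x → g x ≟B y) xs

    private
      concatMap-fibre-↭ : (xs : List A) (ys : List B) → Unique ys →
        concatMap (fibre xs) ys ↭ filter (λ x → g x ∈? ys) xs
      concatMap-fibre-↭ xs []       _           =
        ↭-sym (↭-reflexive (filter-none (λ x → g x ∈? []) {xs} (All.tabulate λ _ ())))
      concatMap-fibre-↭ xs (y ∷ ys) (y∉ys ∷ ys!) =
        ↭-trans (++⁺ˡ (fibre xs y) (concatMap-fibre-↭ xs ys ys!))
          (filter-disjoint-union-↭ (λ x → g x ≟B y) (λ x → g x ∈? ys) (λ x → g x ∈? (y ∷ ys))
            head-or-tail here there (λ gx≡y gx∈ys → All.lookup y∉ys gx∈ys (sym gx≡y)) xs)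
        where
        head-or-tail : ∀ {x} → g x ∈ y ∷ ys → g x ≡ y ⊎ g x ∈ ys
        head-or-tail (here gx≡y)  = inj₁ gx≡y
        head-or-tail (there gx∈) = inj₂ gx∈

    ↭-concatMap-fibre : (xs : List A) (ys : List B) → Unique ys → (∀ {x} → x ∈ xs → g x ∈ ys) →
      xs ↭ concatMap (fibre xs) ys
    ↭-concatMap-fibre xs ys ys! g∈ys = ↭-sym (↭-trans (concatMap-fibre-↭ xs ys ys!)
      (↭-reflexive (filter-all (λ x → g x ∈? ys) (All.tabulate g∈ys))))

    sum-map-fibres : (w : A → ℕ) (xs : List A) (ys : List B) → Unique ys → (∀ {x} → x ∈ xs → g x ∈ ys) →
      sum (map w xs) ≡ sum (map (λ y → sum (map w (fibre xs y))) ys)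
    sum-map-fibres w xs ys ys! g∈ys =
      trans (sum-map-↭ w (↭-concatMap-fibre xs ys ys! g∈ys)) (sum-map-concatMap w (fibre xs) ys)

    length-fibres : (xs : List A) (ys : List B) → Unique ys → (∀ {x} → x ∈ xs → g x ∈ ys) →
      length xs ≡ sum (map (λ y → length (fibre xs y)) ys)
    length-fibres xs ys ys! g∈ys =
      trans (↭-length (↭-concatMap-fibre xs ys ys! g∈ys)) (length-concatMap (fibre xs) ys)

  Unique-map⁺-on : (f : A → B) {xs : List A} → Unique xs →
    (∀ {x y} → x ∈ xs → y ∈ xs → f x ≡ f y → x ≡ y) → Unique (map f xs)
  Unique-map⁺-on f {[]}     []          inj = []
  Unique-map⁺-on f {x ∷ xs} (x∉xs ∷ xs!) inj =
    All.tabulate fx∉ ∷ Unique-map⁺-on f xs! (λ x∈ y∈ → inj (there x∈) (there y∈))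
    where
    fx∉ : ∀ {z} → z ∈ map f xs → f x ≢ z
    fx∉ z∈ fx≡z with ∈-map⁻ f z∈
    ... | y , y∈ , refl = All.lookup x∉xs y∈ (inj (here refl) (there y∈) fx≡z)

  Σ-list : (A → List B) → List A → List (A × B)
  Σ-list ys = concatMap (λ x → map (x ,_) (ys x))

  ∈-Σ-list⁻ : (ys : A → List B) (xs : List A) {p : A × B} → p ∈ Σ-list ys xs → proj₁ p ∈ xs × proj₂ p ∈ ys (proj₁ p)
  ∈-Σ-list⁻ ys xs p∈ with ∈-concatMap⁻ (λ x → map (x ,_) (ys x)) xs p∈
  ... | x , x∈ , p∈′ with ∈-map⁻ (x ,_) p∈′
  ...   | y , y∈ , refl = x∈ , y∈

  ∈-Σ-list⁺ : (ys : A → List B) {xs : List A} {x : A} {y : B} → x ∈ xs → y ∈ ys x → (x , y) ∈ Σ-list ys xs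
  ∈-Σ-list⁺ ys x∈ y∈ = ∈-concatMap⁺ (λ x → map (x ,_) (ys x)) x∈ (∈-map⁺ (_ ,_) y∈)

  Σ-list-unique : (ys : A → List B) (xs : List A) → Unique xs → (∀ {x} → x ∈ xs → Unique (ys x)) →
    Unique (Σ-list ys xs)
  Σ-list-unique ys []       _            _   = []
  Σ-list-unique ys (x ∷ xs) (x∉xs ∷ xs!) ys! =
    Unique.++⁺ (Unique.map⁺ ,-injectiveʳ (ys! (here refl))) (Σ-list-unique ys xs xs! (ys! ∘ there)) disjoint
    where
    disjoint : ∀ {p} → ¬ (p ∈ map (x ,_) (ys x) × p ∈ Σ-list ys xs)
    disjoint (p∈head , p∈tail) with ∈-map⁻ (x ,_) p∈head
    ... | _ , _ , refl = All.lookup x∉xs (proj₁ (∈-Σ-list⁻ ys xs p∈tail)) refl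

  multiplicity-∷-≡ : ∀ {p x} xs → x ≡ p → multiplicity p (x ∷ xs) ≡ suc (multiplicity p xs)
  multiplicity-∷-≡ {p} xs x≡p = cong length (filter-accept (_≟ p) {xs = xs} x≡p)

  multiplicity-∷-≢ : ∀ {p x} xs → x ≢ p → multiplicity p (x ∷ xs) ≡ multiplicity p xs
  multiplicity-∷-≢ {p} xs x≢p = cong length (filter-reject (_≟ p) {xs = xs} x≢p)

  multiplicity-++ : ∀ p xs ys → multiplicity p (xs ++ ys) ≡ multiplicity p xs + multiplicity p ys
  multiplicity-++ p xs ys = trans (cong length (filter-++ (_≟ p) xs ys)) (length-++ (filter (_≟ p) xs))

  multiplicity-replicate-≡ : ∀ p n → multiplicity p (replicate n p) ≡ n
  multiplicity-replicate-≡ p zero    = refl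
  multiplicity-replicate-≡ p (suc n) =
    trans (multiplicity-∷-≡ (replicate n p) refl) (cong suc (multiplicity-replicate-≡ p n))

  multiplicity-replicate-≢ : ∀ {p q} n → q ≢ p → multiplicity p (replicate n q) ≡ 0
  multiplicity-replicate-≢ zero    q≢p = refl
  multiplicity-replicate-≢ (suc n) q≢p =
    trans (multiplicity-∷-≢ (replicate n _) q≢p) (multiplicity-replicate-≢ n q≢p)

  multiplicity-↭ : ∀ p {xs ys} → xs ↭ ys → multiplicity p xs ≡ multiplicity p ys
  multiplicity-↭ p xs↭ys = ↭-length (filter-↭ (_≟ p) xs↭ys)

  multiplicity-filter-≤ : {P : ℕ → Set} (P? : Decidable P) (p : ℕ) (xs : List ℕ) →
    multiplicity p (filter P? xs) ≤ multiplicity p xs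
  multiplicity-filter-≤ P? p xs =
    Sublist.length-mono-≤ (Sublist.filter⁺ (_≟ p) (_≟ p) (λ { refl x≡p → x≡p }) (Sublist.filter-⊆ P? xs))

  multiplicity-concatMap : ∀ p (f : A → List ℕ) xs →
    multiplicity p (concatMap f xs) ≡ sum (map (λ x → multiplicity p (f x)) xs)
  multiplicity-concatMap p f []       = refl
  multiplicity-concatMap p f (x ∷ xs) =
    trans (multiplicity-++ p (f x) _) (cong (multiplicity p (f x) +_) (multiplicity-concatMap p f xs))

  multiplicity-map-injective : (h : ℕ → ℕ) → (∀ {x y} → h x ≡ h y → x ≡ y) →
    ∀ t xs → multiplicity (h t) (map h xs) ≡ multiplicity t xs
  multiplicity-map-injective h inj t []       = refl
  multiplicity-map-injective h inj t (x ∷ xs) with x ≟ t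
  ... | yes x≡t = trans (multiplicity-∷-≡ (map h xs) (cong h x≡t))
                    (trans (cong suc (multiplicity-map-injective h inj t xs)) (sym (multiplicity-∷-≡ xs x≡t)))
  ... | no x≢t  = trans (multiplicity-∷-≢ (map h xs) (x≢t ∘ inj))
                    (trans (multiplicity-map-injective h inj t xs) (sym (multiplicity-∷-≢ xs x≢t)))

  ∈⇒multiplicity>0 : ∀ {p xs} → p ∈ xs → 0 < multiplicity p xs
  ∈⇒multiplicity>0 p∈ = filter-some (_≟ _) (Any.map sym p∈)

  ∉⇒multiplicity≡0 : ∀ {p xs} → p ∉ xs → multiplicity p xs ≡ 0
  ∉⇒multiplicity≡0 {p} {xs} p∉ =
    cong length (filter-none (_≟ p) (All.tabulate λ x∈ x≡p → p∉ (subst (_∈ xs) x≡p x∈)))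

  filter-≟-replicate : ∀ p xs → filter (_≟ p) xs ≡ replicate (multiplicity p xs) p
  filter-≟-replicate p []       = refl
  filter-≟-replicate p (x ∷ xs) with x ≟ p
  ... | yes x≡p = begin
    filter (_≟ p) (x ∷ xs)                  ≡⟨ filter-accept (_≟ p) x≡p ⟩
    x ∷ filter (_≟ p) xs                    ≡⟨ cong₂ _∷_ x≡p (filter-≟-replicate p xs) ⟩
    replicate (suc (multiplicity p xs)) p   ≡⟨ cong (λ n → replicate n p) (multiplicity-∷-≡ xs x≡p) ⟨
    replicate (multiplicity p (x ∷ xs)) p   ∎
    where open ≡-Reasoning
  ... | no x≢p = begin
    filter (_≟ p) (x ∷ xs)                  ≡⟨ filter-reject (_≟ p) x≢p ⟩
    filter (_≟ p) xs                        ≡⟨ filter-≟-replicate p xs ⟩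
    replicate (multiplicity p xs) p         ≡⟨ cong (λ n → replicate n p) (multiplicity-∷-≢ xs x≢p) ⟨
    replicate (multiplicity p (x ∷ xs)) p   ∎
    where open ≡-Reasoning

  removeAll : ℕ → List ℕ → List ℕ
  removeAll p = filter (λ x → ¬? (x ≟ p))

  ∈-removeAll⁻ : ∀ p xs {x} → x ∈ removeAll p xs → x ∈ xs × x ≢ p
  ∈-removeAll⁻ p xs = ∈-filter⁻ (λ x → ¬? (x ≟ p))

  ↭-replicate-++-removeAll : ∀ p xs → xs ↭ replicate (multiplicity p xs) p ++ removeAll p xs
  ↭-replicate-++-removeAll p xs = ↭-trans (filter-∁-↭ (_≟ p) xs)
    (↭-reflexive (cong (_++ removeAll p xs) (filter-≟-replicate p xs)))

  removeAll-replicate-++ : ∀ p n xs → removeAll p (replicate n p ++ xs) ≡ removeAll p xs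
  removeAll-replicate-++ p zero    xs = refl
  removeAll-replicate-++ p (suc n) xs =
    trans (filter-reject (λ x → ¬? (x ≟ p)) (λ p≢p → p≢p refl)) (removeAll-replicate-++ p n xs)

  distinct : List ℕ → List ℕ
  distinct = deduplicate _≟_

  distinct-unique : ∀ xs → Unique (distinct xs)
  distinct-unique = Unique.deduplicate-! _≟_

  ↭-concatMap-replicate-multiplicity : ∀ xs → xs ↭ concatMap (λ p → replicate (multiplicity p xs) p) (distinct xs)
  ↭-concatMap-replicate-multiplicity xs =
    ↭-trans (Fibres.↭-concatMap-fibre id _≟_ xs (distinct xs) (distinct-unique xs) (∈-deduplicate⁺ _≟_))
      (↭-reflexive (concatMap-cong (λ p → filter-≟-replicate p xs) (distinct xs)))

  -- Writing a number as b * k ^ i with k ∤ b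

  module Radix (k′ : ℕ) where

    k : ℕ
    k = 2 + k′

    1<k : 1 < k
    1<k = s≤s (s≤s z≤n)

    k^>0 : ∀ i → 0 < k ^ i
    k^>0 = m^n>0 k

    *k^>0 : ∀ {b} i → 0 < b → 0 < b * k ^ i
    *k^>0 i b>0 = *-mono-≤ b>0 (k^>0 i)

    *k^-suc : ∀ b i → b * k ^ suc i ≡ b * k ^ i * k
    *k^-suc b i = trans (cong (b *_) (*-comm k (k ^ i))) (sym (*-assoc b (k ^ i) k))

    ∣*k^ : ∀ b {i} → 1 ≤ i → k ∣ b * k ^ i
    ∣*k^ b {suc i} _ = subst (k ∣_) (sym (*k^-suc b i)) (n∣m*n (b * k ^ i))

    n<k^n : ∀ n → n < k ^ n
    n<k^n zero    = s≤s z≤n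
    n<k^n (suc n) = begin-strict
      suc n           ≤⟨ n<k^n n ⟩
      k ^ n           <⟨ m<m+n (k ^ n) (k^>0 n) ⟩
      k ^ n + k ^ n   ≡⟨ cong (k ^ n +_) (+-identityʳ (k ^ n)) ⟨
      2 * k ^ n       ≤⟨ *-monoˡ-≤ (k ^ n) {2} {k} (s≤s (s≤s z≤n)) ⟩
      k * k ^ n       ∎
      where open ≤-Reasoning

    -- The fuel bounds the number of divisions by k; base and val use c itself, which suffices.
    decompose : (fuel c : ℕ) → ℕ × ℕ
    decompose zero       c       = c , 0
    decompose (suc fuel) zero    = 0 , 0
    decompose (suc fuel) (suc c) with suc c % k ≟ 0
    ... | yes _ = map₂ suc (decompose fuel (suc c / k))
    ... | no _  = suc c , 0

    base val : ℕ → ℕ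
    base c = proj₁ (decompose c c)
    val  c = proj₂ (decompose c c)

    decompose-∣ : ∀ fuel c → 0 < c → k ∣ c → decompose (suc fuel) c ≡ map₂ suc (decompose fuel (c / k))
    decompose-∣ fuel (suc c) _ k∣c with suc c % k ≟ 0
    ... | yes _    = refl
    ... | no  %k≢0 = ⊥-elim (%k≢0 (n∣m⇒m%n≡0 (suc c) k k∣c))

    decompose-∤ : ∀ fuel c → 0 < c → ¬ k ∣ c → decompose (suc fuel) c ≡ (c , 0)
    decompose-∤ fuel (suc c) _ k∤c with suc c % k ≟ 0
    ... | yes %k≡0 = ⊥-elim (k∤c (m%n≡0⇒n∣m (suc c) k %k≡0))
    ... | no _     = refl

    decompose-correct : ∀ fuel c → proj₁ (decompose fuel c) * k ^ proj₂ (decompose fuel c) ≡ c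
    decompose-correct zero       c       = *-identityʳ c
    decompose-correct (suc fuel) zero    = refl
    decompose-correct (suc fuel) (suc c) with suc c % k ≟ 0
    ... | no _     = *-identityʳ (suc c)
    ... | yes %k≡0 = begin
      b * k ^ suc i   ≡⟨ *k^-suc b i ⟩
      b * k ^ i * k   ≡⟨ cong (_* k) (decompose-correct fuel (suc c / k)) ⟩
      suc c / k * k   ≡⟨ m/n*n≡m (m%n≡0⇒n∣m (suc c) k %k≡0) ⟩
      suc c           ∎
      where
      open ≡-Reasoning
      b = proj₁ (decompose fuel (suc c / k))
      i = proj₂ (decompose fuel (suc c / k))

    decompose-∤-base : ∀ fuel c → c ≤ fuel → 0 < c → ¬ k ∣ proj₁ (decompose fuel c)
    decompose-∤-base (suc fuel) (suc c) c≤fuel _ with suc c % k ≟ 0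
    ... | no %k≢0 = %k≢0 ∘ n∣m⇒m%n≡0 (suc c) k
    ... | yes %k≡0 = decompose-∤-base fuel (suc c / k) c/k≤fuel c/k>0
      where
      c/k≤fuel : suc c / k ≤ fuel
      c/k≤fuel = ≤-pred (≤-trans (m/n<m (suc c) k 1<k) c≤fuel)
      c/k>0 : 0 < suc c / k
      c/k>0 with suc c / k | m/n*n≡m (m%n≡0⇒n∣m (suc c) k %k≡0)
      ... | suc _ | _ = s≤s z≤n

    base-*-k^val : ∀ c → base c * k ^ val c ≡ c
    base-*-k^val c = decompose-correct c c

    base>0 : ∀ {c} → 0 < c → 0 < base c
    base>0 {c} c>0 with base c | base-*-k^val c
    ... | suc _ | _ = s≤s z≤n
    ... | zero  | c≡0 = ⊥-elim (<⇒≢ c>0 c≡0)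

    ∤-base : ∀ {c} → 0 < c → ¬ k ∣ base c
    ∤-base {c} = decompose-∤-base c c ≤-refl

    decompose-*k^ : ∀ {b} → 0 < b → ¬ k ∣ b → ∀ i fuel → i < fuel → decompose fuel (b * k ^ i) ≡ (b , i)
    decompose-*k^ {b} b>0 k∤b zero    (suc fuel) _ =
      trans (cong (decompose (suc fuel)) (*-identityʳ b)) (decompose-∤ fuel b b>0 k∤b)
    decompose-*k^ {b} b>0 k∤b (suc i) (suc fuel) (s≤s i<fuel) = begin
      decompose (suc fuel) (b * k ^ suc i)              ≡⟨ decompose-∣ fuel _ (*k^>0 (suc i) b>0) (∣*k^ b {suc i} (s≤s z≤n)) ⟩
      map₂ suc (decompose fuel (b * k ^ suc i / k))     ≡⟨ cong (map₂ suc ∘ decompose fuel) /k ⟩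
      map₂ suc (decompose fuel (b * k ^ i))             ≡⟨ cong (map₂ suc) (decompose-*k^ b>0 k∤b i fuel i<fuel) ⟩
      (b , suc i)                                       ∎
      where
      open ≡-Reasoning
      /k : b * k ^ suc i / k ≡ b * k ^ i
      /k = trans (cong (_/ k) (*k^-suc b i)) (m*n/n≡m (b * k ^ i) k)

    decompose-*k^-self : ∀ {b} → 0 < b → ¬ k ∣ b → ∀ i → decompose (b * k ^ i) (b * k ^ i) ≡ (b , i)
    decompose-*k^-self {suc b} b>0 k∤b i =
      decompose-*k^ b>0 k∤b i _ (≤-trans (n<k^n i) (m≤m+n (k ^ i) (b * k ^ i)))

    base-*k^ : ∀ {b} → 0 < b → ¬ k ∣ b → ∀ i → base (b * k ^ i) ≡ b
    base-*k^ b>0 k∤b i = cong proj₁ (decompose-*k^-self b>0 k∤b i)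

    val-*k^ : ∀ {b} → 0 < b → ¬ k ∣ b → ∀ i → val (b * k ^ i) ≡ i
    val-*k^ b>0 k∤b i = cong proj₂ (decompose-*k^-self b>0 k∤b i)

    *k^-injective : ∀ {b b′ i i′} → 0 < b → ¬ k ∣ b → 0 < b′ → ¬ k ∣ b′ →
      b * k ^ i ≡ b′ * k ^ i′ → b ≡ b′ × i ≡ i′
    *k^-injective {i = i} {i′} b>0 k∤b b′>0 k∤b′ eq =
      trans (sym (base-*k^ b>0 k∤b i)) (trans (cong base eq) (base-*k^ b′>0 k∤b′ i′)) ,
      trans (sym (val-*k^ b>0 k∤b i)) (trans (cong val eq) (val-*k^ b′>0 k∤b′ i′))

    -- Splitting every part b * k ^ i into k ^ i parts b

    expand : ℕ → List ℕ
    expand c = replicate (k ^ val c) (base c)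

    expandAll : List ℕ → List ℕ
    expandAll xs = sort (concatMap expand xs)

    sum-expand : ∀ c → sum (expand c) ≡ c
    sum-expand c = trans (sum-replicate (k ^ val c) (base c)) (trans (*-comm (k ^ val c) (base c)) (base-*-k^val c))

    expand-*k^ : ∀ {b} → 0 < b → ¬ k ∣ b → ∀ i → expand (b * k ^ i) ≡ replicate (k ^ i) b
    expand-*k^ b>0 k∤b i rewrite val-*k^ b>0 k∤b i | base-*k^ b>0 k∤b i = refl

    concatMap-expand-replicate : ∀ {b} → 0 < b → ¬ k ∣ b → ∀ i j →
      concatMap expand (replicate j (b * k ^ i)) ≡ replicate (j * k ^ i) b
    concatMap-expand-replicate b>0 k∤b i zero    = refl
    concatMap-expand-replicate b>0 k∤b i (suc j) =
      trans (cong₂ _++_ (expand-*k^ b>0 k∤b i) (concatMap-expand-replicate b>0 k∤b i j)) (replicate-++ (k ^ i) _ _)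

    concatMap-expand-∤ : ∀ {xs} → All (0 <_) xs → All (λ x → ¬ k ∣ x) xs → concatMap expand xs ≡ xs
    concatMap-expand-∤ {[]}     _           _           = refl
    concatMap-expand-∤ {x ∷ xs} (x>0 ∷ xs>0) (k∤x ∷ k∤xs) =
      cong₂ _++_ (trans (cong expand (sym (*-identityʳ x))) (expand-*k^ x>0 k∤x 0)) (concatMap-expand-∤ xs>0 k∤xs)

    sum-expandAll : ∀ xs → sum (expandAll xs) ≡ sum xs
    sum-expandAll xs = trans (sum-↭ (sort-↭ (concatMap expand xs))) (sum-concatMap-expand xs)
      where
      sum-concatMap-expand : ∀ xs → sum (concatMap expand xs) ≡ sum xs
      sum-concatMap-expand []       = refl
      sum-concatMap-expand (x ∷ xs) = trans (sum-++ (expand x) _) (cong₂ _+_ (sum-expand x) (sum-concatMap-expand xs))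

    ∈-expandAll⁻ : ∀ xs {y} → y ∈ expandAll xs → Σ ℕ λ x → x ∈ xs × y ≡ base x
    ∈-expandAll⁻ xs y∈ with ∈-concatMap⁻ expand xs (∈-resp-↭ (sort-↭ (concatMap expand xs)) y∈)
    ... | x , x∈ , y∈expand = x , x∈ , ∈-replicate⁻ (k ^ val x) y∈expand

    ∈-expandAll⁺ : ∀ {xs x} → x ∈ xs → base x ∈ expandAll xs
    ∈-expandAll⁺ {xs} {x} x∈ = ∈-resp-↭ (↭-sym (sort-↭ (concatMap expand xs)))
      (∈-concatMap⁺ expand x∈ (∈-replicate⁺ (k ^ val x) (k^>0 (val x))))

    expandAll-≡ : ∀ xs {ys} → Linked _≥_ ys → concatMap expand xs ↭ ys → expandAll xs ≡ ys
    expandAll-≡ xs ys↘ xs↭ys = nonincreasing-↭⇒≡ (sort-↗ (concatMap expand xs)) ys↘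
      (↭-trans (sort-↭ (concatMap expand xs)) xs↭ys)

    expandAll-InO : ∀ {n xs} → IsPartition n xs → InO k n (expandAll xs)
    expandAll-InO {n} {xs} (_ , xs>0 , Σxs) =
      (sort-↗ (concatMap expand xs) , All.tabulate y>0 , trans (sum-expandAll xs) Σxs) , All.tabulate k∤y
      where
      y>0 : ∀ {y} → y ∈ expandAll xs → 0 < y
      y>0 y∈ with ∈-expandAll⁻ xs y∈
      ... | x , x∈ , refl = base>0 (All.lookup xs>0 x∈)
      k∤y : ∀ {y} → y ∈ expandAll xs → ¬ k ∣ y
      k∤y y∈ with ∈-expandAll⁻ xs y∈
      ... | x , x∈ , refl = ∤-base (All.lookup xs>0 x∈)

    -- Base-k digits, as a list of exponents

    sumPowers : List ℕ → ℕ
    sumPowers ts = sum (map (k ^_) ts)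

    -- For f ≤ fuel, digitExponents fuel j f contains j + t exactly as often as the t-th base-k digit of f.
    digitExponents : (fuel j f : ℕ) → List ℕ
    digitExponents zero       j f = []
    digitExponents (suc fuel) j f = replicate (f % k) j ++ digitExponents fuel (suc j) (f / k)

    digitExponents-0 : ∀ fuel j → digitExponents fuel j 0 ≡ []
    digitExponents-0 zero       j = refl
    digitExponents-0 (suc fuel) j = digitExponents-0 fuel (suc j)

    /k≤fuel : ∀ {f fuel} → f ≤ suc fuel → f / k ≤ fuel
    /k≤fuel {zero}  _      = z≤n
    /k≤fuel {suc f} f≤fuel = ≤-pred (≤-trans (m/n<m (suc f) k 1<k) f≤fuel)

    sumPowers-replicate-++ : ∀ a j ts → sumPowers (replicate a j ++ ts) ≡ a * k ^ j + sumPowers ts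
    sumPowers-replicate-++ a j ts = begin
      sum (map (k ^_) (replicate a j ++ ts))                    ≡⟨ cong sum (map-++ (k ^_) (replicate a j) ts) ⟩
      sum (map (k ^_) (replicate a j) ++ map (k ^_) ts)          ≡⟨ sum-++ (map (k ^_) (replicate a j)) _ ⟩
      sum (map (k ^_) (replicate a j)) + sumPowers ts            ≡⟨ cong (_+ sumPowers ts) (cong sum (map-replicate (k ^_) a j)) ⟩
      sum (replicate a (k ^ j)) + sumPowers ts                   ≡⟨ cong (_+ sumPowers ts) (sum-replicate a (k ^ j)) ⟩
      a * k ^ j + sumPowers ts                                   ∎
      where open ≡-Reasoning

    sumPowers-map-suc : ∀ ts → sumPowers (map suc ts) ≡ sumPowers ts * k
    sumPowers-map-suc ts = begin
      sum (map (k ^_) (map suc ts))       ≡⟨ cong sum (map-∘ ts) ⟨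
      sum (map (λ t → k * k ^ t) ts)      ≡⟨ sum-map-*ˡ k (k ^_) ts ⟩
      k * sumPowers ts                    ≡⟨ *-comm k (sumPowers ts) ⟩
      sumPowers ts * k                    ∎
      where open ≡-Reasoning

    sumPowers-digitExponents : ∀ fuel j f → f ≤ fuel → sumPowers (digitExponents fuel j f) ≡ k ^ j * f
    sumPowers-digitExponents zero       j f z≤n    = sym (*-zeroʳ (k ^ j))
    sumPowers-digitExponents (suc fuel) j f f≤fuel = begin
      sumPowers (replicate r j ++ digitExponents fuel (suc j) q)   ≡⟨ sumPowers-replicate-++ r j _ ⟩
      r * k ^ j + sumPowers (digitExponents fuel (suc j) q)        ≡⟨ cong (r * k ^ j +_) (sumPowers-digitExponents fuel (suc j) q (/k≤fuel f≤fuel)) ⟩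
      r * k ^ j + k * k ^ j * q                                    ≡⟨ regroup r q (k ^ j) k ⟩
      k ^ j * (r + q * k)                                          ≡⟨ cong (k ^ j *_) (m≡m%n+[m/n]*n f k) ⟨
      k ^ j * f                                                    ∎
      where
      open ≡-Reasoning
      r = f % k
      q = f / k
      regroup : ∀ r q p k → r * p + k * p * q ≡ p * (r + q * k)
      regroup = solve-∀

    digitExponents-≥ : ∀ fuel j f → All (j ≤_) (digitExponents fuel j f)
    digitExponents-≥ zero       j f = []
    digitExponents-≥ (suc fuel) j f = All.++⁺ (All.replicate⁺ (f % k) ≤-refl)
      (All.map (≤-trans (n≤1+n j)) (digitExponents-≥ fuel (suc j) (f / k)))

    multiplicity-digitExponents<k : ∀ fuel j f t → multiplicity t (digitExponents fuel j f) < k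
    multiplicity-digitExponents<k zero       j f t = s≤s z≤n
    multiplicity-digitExponents<k (suc fuel) j f t with t ≟ j
    ... | yes refl = begin-strict
      multiplicity t (replicate r t ++ higher)                  ≡⟨ multiplicity-++ t (replicate r t) higher ⟩
      multiplicity t (replicate r t) + multiplicity t higher    ≡⟨ cong₂ _+_ (multiplicity-replicate-≡ t r) (∉⇒multiplicity≡0 t∉higher) ⟩
      r + 0                                                     ≡⟨ +-identityʳ r ⟩
      r                                                         <⟨ m%n<n f k ⟩
      k                                                         ∎
      where
      open ≤-Reasoning
      r = f % k
      higher = digitExponents fuel (suc t) (f / k)
      t∉higher : t ∉ higher
      t∉higher t∈ = 1+n≰n (All.lookup (digitExponents-≥ fuel (suc t) (f / k)) t∈)
    ... | no t≢j = begin-strict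
      multiplicity t (replicate r j ++ higher)                  ≡⟨ multiplicity-++ t (replicate r j) higher ⟩
      multiplicity t (replicate r j) + multiplicity t higher    ≡⟨ cong (_+ multiplicity t higher) (multiplicity-replicate-≢ r (t≢j ∘ sym)) ⟩
      multiplicity t higher                                     <⟨ multiplicity-digitExponents<k fuel (suc j) (f / k) t ⟩
      k                                                         ∎
      where
      open ≤-Reasoning
      r = f % k
      higher = digitExponents fuel (suc j) (f / k)

    map-suc-pred : ∀ {ts} → All (_≢ 0) ts → map suc (map pred ts) ≡ ts
    map-suc-pred {[]}         []           = refl
    map-suc-pred {zero ∷ _}   (0≢0 ∷ _)    = ⊥-elim (0≢0 refl)
    map-suc-pred {suc t ∷ _}  (_ ∷ ts≢0)   = cong (suc t ∷_) (map-suc-pred ts≢0)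

    lowered : List ℕ → List ℕ
    lowered ts = map pred (removeAll 0 ts)

    ↭-zeros-++-raised : ∀ ts → ts ↭ replicate (multiplicity 0 ts) 0 ++ map suc (lowered ts)
    ↭-zeros-++-raised ts = subst (λ us → ts ↭ replicate (multiplicity 0 ts) 0 ++ us)
      (sym (map-suc-pred (All.tabulate (proj₂ ∘ ∈-removeAll⁻ 0 ts)))) (↭-replicate-++-removeAll 0 ts)

    multiplicity-lowered : ∀ t ts → multiplicity t (lowered ts) ≤ multiplicity (suc t) ts
    multiplicity-lowered t ts = begin
      multiplicity t (lowered ts)                       ≡⟨ multiplicity-map-injective suc suc-injective t (lowered ts) ⟨
      multiplicity (suc t) (map suc (lowered ts))       ≡⟨ cong (multiplicity (suc t)) (map-suc-pred (All.tabulate (proj₂ ∘ ∈-removeAll⁻ 0 ts))) ⟩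
      multiplicity (suc t) (removeAll 0 ts)             ≤⟨ multiplicity-filter-≤ (λ x → ¬? (x ≟ 0)) (suc t) ts ⟩
      multiplicity (suc t) ts                           ∎
      where open ≤-Reasoning

    sumPowers-zeros-++-raised : ∀ a ts → sumPowers (replicate a 0 ++ map suc ts) ≡ a + sumPowers ts * k
    sumPowers-zeros-++-raised a ts = trans (sumPowers-replicate-++ a 0 (map suc ts))
      (cong₂ _+_ (*-identityʳ a) (sumPowers-map-suc ts))

    +*k%k : ∀ {a} m → a < k → (a + m * k) % k ≡ a
    +*k%k {a} m a<k = trans ([m+kn]%n≡m%n a m k) (m<n⇒m%n≡m a<k)

    +*k/k : ∀ {a} m → a < k → (a + m * k) / k ≡ m
    +*k/k {a} m a<k = trans (+-distrib-/ a (m * k) no-carry) (cong₂ _+_ (m<n⇒m/n≡0 a<k) (m*n/n≡m m k))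
      where
      no-carry : a % k + m * k % k < k
      no-carry = subst (_< k) (sym (cong₂ _+_ (m<n⇒m%n≡m a<k) (m*n%n≡0 m k))) (subst (_< k) (sym (+-identityʳ a)) a<k)

    sumPowers>0 : ∀ t ts → 0 < sumPowers (t ∷ ts)
    sumPowers>0 t ts = ≤-trans (k^>0 t) (m≤m+n (k ^ t) _)

    -- Uniqueness of base-k expansions.
    digitExponents-sumPowers : ∀ fuel j ts → (∀ t → multiplicity t ts < k) → sumPowers ts ≤ fuel →
      digitExponents fuel j (sumPowers ts) ↭ map (j +_) ts
    digitExponents-sumPowers zero       j []       _    _      = ↭-refl
    digitExponents-sumPowers zero       j (t ∷ ts) _    Σ≤fuel = ⊥-elim (1+n≰n (<-≤-trans (sumPowers>0 t ts) Σ≤fuel))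
    digitExponents-sumPowers (suc fuel) j []       _    _      = ↭-reflexive (digitExponents-0 (suc fuel) j)
    digitExponents-sumPowers (suc fuel) j ts@(t ∷ us) mult<k Σ≤fuel = begin
      replicate (sumPowers ts % k) j ++ digitExponents fuel (suc j) (sumPowers ts / k)
                                                                 ≡⟨ cong₂ (λ r q → replicate r j ++ digitExponents fuel (suc j) q) Σ%k Σ/k ⟩
      replicate a j ++ digitExponents fuel (suc j) (sumPowers ts′)  ↭⟨ ++⁺ˡ (replicate a j) rest ⟩
      replicate a j ++ map (suc j +_) ts′                        ≡⟨ shifted ⟨
      map (j +_) (replicate a 0 ++ map suc ts′)                  ↭⟨ map-↭ (j +_) (↭-sym (↭-zeros-++-raised ts)) ⟩
      map (j +_) ts                                              ∎
      where
      open PermutationReasoning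
      a = multiplicity 0 ts
      ts′ = lowered ts
      Σts : sumPowers ts ≡ a + sumPowers ts′ * k
      Σts = trans (sum-map-↭ (k ^_) (↭-zeros-++-raised ts)) (sumPowers-zeros-++-raised a ts′)
      Σ%k : sumPowers ts % k ≡ a
      Σ%k = trans (cong (_% k) Σts) (+*k%k (sumPowers ts′) (mult<k 0))
      Σ/k : sumPowers ts / k ≡ sumPowers ts′
      Σ/k = trans (cong (_/ k) Σts) (+*k/k (sumPowers ts′) (mult<k 0))
      rest : digitExponents fuel (suc j) (sumPowers ts′) ↭ map (suc j +_) ts′
      rest = digitExponents-sumPowers fuel (suc j) ts′
        (λ t → ≤-<-trans (multiplicity-lowered t ts) (mult<k (suc t)))
        (subst (_≤ fuel) Σ/k (/k≤fuel Σ≤fuel))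
      shifted : map (j +_) (replicate a 0 ++ map suc ts′) ≡ replicate a j ++ map (suc j +_) ts′
      shifted = trans (map-++ (j +_) (replicate a 0) (map suc ts′))
        (cong₂ _++_ (trans (map-replicate (j +_) a 0) (cong (replicate a) (+-identityʳ j)))
                    (trans (sym (map-∘ ts′)) (map-cong (+-suc j) ts′)))

    -- Merging j * k ^ a equal parts b into j parts b * k ^ a

    *k≤⇒≤/k : ∀ m f → m * k ≤ f → m ≤ f / k
    *k≤⇒≤/k m f mk≤f = subst (_≤ f / k) (m*n/n≡m m k) (/-monoˡ-≤ k mk≤f)

    ≤/k⇒*k≤ : ∀ m f → m ≤ f / k → m * k ≤ f
    ≤/k⇒*k≤ m f m≤f/k = ≤-trans (*-monoˡ-≤ k m≤f/k) (m/n*n≤m f k)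

    oneTo : ℕ → List ℕ
    oneTo m = map suc (upTo m)

    ∈-oneTo⁻ : ∀ {j m} → j ∈ oneTo m → 1 ≤ j × j ≤ m
    ∈-oneTo⁻ j∈ with ∈-map⁻ suc j∈
    ... | i , i∈ , refl = s≤s z≤n , ∈-upTo⁻ i∈

    ∈-oneTo⁺ : ∀ {j m} → 1 ≤ j → j ≤ m → j ∈ oneTo m
    ∈-oneTo⁺ {suc i} _ i<m = ∈-map⁺ suc (∈-upTo⁺ i<m)

    oneTo-unique : ∀ m → Unique (oneTo m)
    oneTo-unique m = Unique.map⁺ suc-injective (Unique.upTo⁺ m)

    -- For f ≤ fuel, merges fuel a f lists the pairs (a + s , j) with j ≥ 1 and j * k ^ (1 + s) ≤ f.
    merges : (fuel a f : ℕ) → List (ℕ × ℕ)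
    merges zero       a f = []
    merges (suc fuel) a f = map (a ,_) (oneTo (f / k)) ++ merges fuel (suc a) (f / k)

    ∈-merges⁻ : ∀ fuel a f {a′ j} → (a′ , j) ∈ merges fuel a f →
      Σ ℕ λ s → a′ ≡ a + s × 1 ≤ j × j * k ^ suc s ≤ f
    ∈-merges⁻ (suc fuel) a f p∈ with ∈-++⁻ (map (a ,_) (oneTo (f / k))) p∈
    ... | inj₁ p∈here with ∈-map⁻ (a ,_) p∈here
    ...   | j , j∈ , refl = let 1≤j , j≤f/k = ∈-oneTo⁻ j∈ in
      0 , sym (+-identityʳ a) , 1≤j , subst (_≤ f) (cong (j *_) (sym (*-identityʳ k))) (≤/k⇒*k≤ j f j≤f/k)
    ∈-merges⁻ (suc fuel) a f {j = j} p∈ | inj₂ p∈later with ∈-merges⁻ fuel (suc a) (f / k) p∈later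
    ... | s , refl , 1≤j , jks≤f/k = suc s , sym (+-suc a s) , 1≤j ,
      subst (_≤ f) (sym (*k^-suc j (suc s))) (≤/k⇒*k≤ _ f jks≤f/k)

    ∈-merges⁺ : ∀ fuel a f s {j} → 1 ≤ j → j * k ^ suc s ≤ f → f ≤ fuel → (a + s , j) ∈ merges fuel a f
    ∈-merges⁺ zero       a f s {j} 1≤j jks≤f f≤0 = ⊥-elim (1+n≰n (≤-trans (*k^>0 (suc s) 1≤j) (≤-trans jks≤f f≤0)))
    ∈-merges⁺ (suc fuel) a f zero {j} 1≤j jk≤f _ =
      ∈-++⁺ˡ (subst (λ a′ → (a′ , j) ∈ map (a ,_) (oneTo (f / k))) (sym (+-identityʳ a))
        (∈-map⁺ (a ,_) (∈-oneTo⁺ 1≤j (*k≤⇒≤/k j f (subst (_≤ f) (cong (j *_) (*-identityʳ k)) jk≤f)))))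
    ∈-merges⁺ (suc fuel) a f (suc s) {j} 1≤j jks≤f f≤fuel =
      ∈-++⁺ʳ (map (a ,_) (oneTo (f / k)))
        (subst (λ a′ → (a′ , j) ∈ merges fuel (suc a) (f / k)) (sym (+-suc a s))
          (∈-merges⁺ fuel (suc a) (f / k) s 1≤j
            (*k≤⇒≤/k (j * k ^ suc s) f (subst (_≤ f) (*k^-suc j (suc s)) jks≤f)) (/k≤fuel f≤fuel)))

    merges-unique : ∀ fuel a f → Unique (merges fuel a f)
    merges-unique zero       a f = []
    merges-unique (suc fuel) a f =
      Unique.++⁺ (Unique.map⁺ ,-injectiveʳ (oneTo-unique (f / k))) (merges-unique fuel (suc a) (f / k)) disjoint
      where
      disjoint : ∀ {p} → ¬ (p ∈ map (a ,_) (oneTo (f / k)) × p ∈ merges fuel (suc a) (f / k))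
      disjoint (p∈here , p∈later) with ∈-map⁻ (a ,_) p∈here
      ... | _ , _ , refl with ∈-merges⁻ fuel (suc a) (f / k) p∈later
      ...   | s , a≡1+a+s , _ = 1+n≰n (subst (suc a ≤_) (sym a≡1+a+s) (m≤m+n (suc a) s))

    -- Legendre's formula, with Σ_{a ≥ 1} ⌊f / k ^ a⌋ counted by the merges.
    length-digitExponents+merges : ∀ fuel j a f → f ≤ fuel →
      length (digitExponents fuel j f) + suc k′ * length (merges fuel a f) ≡ f
    length-digitExponents+merges zero       j a f z≤n = *-zeroʳ k′
    length-digitExponents+merges (suc fuel) j a f f≤fuel = begin
      length (replicate r j ++ D) + suc k′ * length (map (a ,_) (oneTo q) ++ M)
        ≡⟨ cong₂ (λ x y → x + suc k′ * y) (length-++ (replicate r j)) (length-++ (map (a ,_) (oneTo q))) ⟩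
      length (replicate r j) + length D + suc k′ * (length (map (a ,_) (oneTo q)) + length M)
        ≡⟨ cong₂ (λ x y → x + length D + suc k′ * (y + length M)) (length-replicate r) length-oneTo ⟩
      r + length D + suc k′ * (q + length M)
        ≡⟨ regroup r (length D) (length M) q k′ ⟩
      r + (length D + suc k′ * length M) + suc k′ * q
        ≡⟨ cong (λ x → r + x + suc k′ * q) (length-digitExponents+merges fuel (suc j) (suc a) q (/k≤fuel f≤fuel)) ⟩
      r + q + suc k′ * q
        ≡⟨ regroup′ r q k′ ⟩
      r + q * k
        ≡⟨ m≡m%n+[m/n]*n f k ⟨
      f ∎
      where
      open ≡-Reasoning
      r = f % k
      q = f / k
      D = digitExponents fuel (suc j) q
      M = merges fuel (suc a) q
      length-oneTo : length (map (a ,_) (oneTo q)) ≡ q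
      length-oneTo = trans (length-map (a ,_) (oneTo q)) (trans (length-map suc (upTo q)) (length-upTo q))
      regroup : ∀ r d m q k′ → r + d + suc k′ * (q + m) ≡ r + (d + suc k′ * m) + suc k′ * q
      regroup = solve-∀
      regroup′ : ∀ r q k′ → r + q + suc k′ * q ≡ r + q * suc (suc k′)
      regroup′ = solve-∀

    -- Glaisher's bijection from 𝒪_k(n) to 𝒟_k(n)

    digitParts : ℕ → ℕ → List ℕ
    digitParts b f = map (λ t → b * k ^ t) (digitExponents f 0 f)

    toD′ : List ℕ → List ℕ
    toD′ xs = concatMap (λ b → digitParts b (multiplicity b xs)) (distinct xs)

    toD : List ℕ → List ℕ
    toD xs = sort (toD′ xs)

    concatMap-expand-digitParts : ∀ {b} → 0 < b → ¬ k ∣ b → ∀ f → concatMap expand (digitParts b f) ≡ replicate f b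
    concatMap-expand-digitParts {b} b>0 k∤b f = begin
      concatMap expand (map (λ t → b * k ^ t) ts)        ≡⟨ concatMap-map expand (λ t → b * k ^ t) ts ⟩
      concatMap (λ t → expand (b * k ^ t)) ts            ≡⟨ concatMap-cong (expand-*k^ b>0 k∤b) ts ⟩
      concatMap (λ t → replicate (k ^ t) b) ts           ≡⟨ concatMap-replicate (k ^_) b ts ⟩
      replicate (sumPowers ts) b                         ≡⟨ cong (λ m → replicate m b) (sumPowers-digitExponents f 0 f ≤-refl) ⟩
      replicate (1 * f) b                                ≡⟨ cong (λ m → replicate m b) (*-identityˡ f) ⟩
      replicate f b                                      ∎
      where
      open ≡-Reasoning
      ts = digitExponents f 0 f

    ∈-digitParts⁻ : ∀ {b f p} → p ∈ digitParts b f → Σ ℕ λ t → p ≡ b * k ^ t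
    ∈-digitParts⁻ {b} p∈ with ∈-map⁻ (λ t → b * k ^ t) p∈
    ... | t , _ , p≡ = t , p≡

    ∈-toD⁻ : ∀ xs {p} → p ∈ toD xs → Σ ℕ λ b → b ∈ xs × Σ ℕ λ t → p ≡ b * k ^ t
    ∈-toD⁻ xs p∈ with ∈-concatMap⁻ (λ b → digitParts b (multiplicity b xs)) (distinct xs) (∈-resp-↭ (sort-↭ (toD′ xs)) p∈)
    ... | b , b∈ , p∈parts = b , ∈-deduplicate⁻ _≟_ xs b∈ , ∈-digitParts⁻ {b} {multiplicity b xs} p∈parts

    multiplicity-digitParts<k : ∀ {b} → 0 < b → ¬ k ∣ b → ∀ f p → multiplicity p (digitParts b f) < k
    multiplicity-digitParts<k {b} b>0 k∤b f p with Any.any? (p ≟_) (digitParts b f)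
    ... | no p∉ = subst (_< k) (sym (∉⇒multiplicity≡0 p∉)) (s≤s z≤n)
    ... | yes p∈ with ∈-digitParts⁻ {b} {f} p∈
    ...   | t , refl = subst (_< k)
      (sym (multiplicity-map-injective (λ t → b * k ^ t) (λ eq → proj₂ (*k^-injective b>0 k∤b b>0 k∤b eq)) t
        (digitExponents f 0 f)))
      (multiplicity-digitExponents<k f 0 f t)

    expandAll-toD : ∀ {n xs} → InO k n xs → expandAll (toD xs) ≡ xs
    expandAll-toD {xs = xs} ((xs↘ , xs>0 , _) , k∤xs) = expandAll-≡ (toD xs) xs↘ (begin
      concatMap expand (toD xs)                                   ↭⟨ concatMap-↭ expand (sort-↭ (toD′ xs)) ⟩
      concatMap expand (toD′ xs)                                  ≡⟨ concatMap-concatMap expand _ (distinct xs) ⟩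
      concatMap (λ b → concatMap expand (digitParts b (multiplicity b xs))) (distinct xs)
                                                                  ↭⟨ concatMap-↭-pointwise _ _ (distinct xs) expand-class ⟩
      concatMap (λ b → replicate (multiplicity b xs) b) (distinct xs)
                                                                  ↭⟨ ↭-concatMap-replicate-multiplicity xs ⟨
      xs                                                          ∎)
      where
      open PermutationReasoning
      expand-class : ∀ {b} → b ∈ distinct xs → concatMap expand (digitParts b (multiplicity b xs)) ↭ replicate (multiplicity b xs) b
      expand-class b∈ = let b∈xs = ∈-deduplicate⁻ _≟_ xs b∈ in
        ↭-reflexive (concatMap-expand-digitParts (All.lookup xs>0 b∈xs) (All.lookup k∤xs b∈xs) (multiplicity _ xs))

    toD-InD : ∀ {n xs} → InO k n xs → InD k n (toD xs)
    toD-InD {n} {xs} O@((_ , xs>0 , Σxs) , k∤xs) =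
      (sort-↗ (toD′ xs) , All.tabulate p>0 , Σ-toD) , multiplicity<k
      where
      p>0 : ∀ {p} → p ∈ toD xs → 0 < p
      p>0 p∈ with ∈-toD⁻ xs p∈
      ... | b , b∈ , t , refl = *k^>0 t (All.lookup xs>0 b∈)
      Σ-toD : sum (toD xs) ≡ n
      Σ-toD = trans (sym (sum-expandAll (toD xs))) (trans (cong sum (expandAll-toD O)) Σxs)
      multiplicity<k : ∀ p → multiplicity p (toD xs) < k
      multiplicity<k zero = subst (_< k) (sym (∉⇒multiplicity≡0 (λ 0∈ → 1+n≰n (p>0 0∈)))) (s≤s z≤n)
      multiplicity<k p@(suc _) = begin-strict
        multiplicity p (toD xs)                  ≡⟨ multiplicity-↭ p (sort-↭ (toD′ xs)) ⟩
        multiplicity p (toD′ xs)                 ≡⟨ multiplicity-concatMap p _ (distinct xs) ⟩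
        sum (map g (distinct xs))                ≤⟨ sum-map-≤-single-support g (distinct xs) (base p) (distinct-unique xs) g≡0 ⟩
        g (base p)                               <⟨ multiplicity-digitParts<k (base>0 {p} (s≤s z≤n)) (∤-base {p} (s≤s z≤n)) (multiplicity (base p) xs) p ⟩
        k                                        ∎
        where
        open ≤-Reasoning
        g : ℕ → ℕ
        g b = multiplicity p (digitParts b (multiplicity b xs))
        g≡0 : ∀ {b} → b ∈ distinct xs → b ≢ base p → g b ≡ 0
        g≡0 {b} b∈ b≢base = ∉⇒multiplicity≡0 p∉
          where
          b∈xs = ∈-deduplicate⁻ _≟_ xs b∈
          p∉ : p ∉ digitParts b (multiplicity b xs)
          p∉ p∈ with ∈-digitParts⁻ {b} {multiplicity b xs} p∈
          ... | t , p≡ = b≢base (sym (trans (cong base p≡) (base-*k^ (All.lookup xs>0 b∈xs) (All.lookup k∤xs b∈xs) t)))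

    class : List ℕ → ℕ → List ℕ
    class = Fibres.fibre base _≟_

    multiplicity-concatMap-expand : ∀ b xs → multiplicity b (concatMap expand xs) ≡ sumPowers (map val (class xs b))
    multiplicity-concatMap-expand b []       = refl
    multiplicity-concatMap-expand b (x ∷ xs) with base x ≟ b
    ... | yes refl = begin
      multiplicity b (expand x ++ concatMap expand xs)                     ≡⟨ multiplicity-++ b (expand x) _ ⟩
      multiplicity b (expand x) + multiplicity b (concatMap expand xs)     ≡⟨ cong₂ _+_ (multiplicity-replicate-≡ b _) (multiplicity-concatMap-expand b xs) ⟩
      k ^ val x + sumPowers (map val (class xs b))                         ≡⟨ cong (sumPowers ∘ map val) (filter-accept (λ x → base x ≟ b) {x} {xs} refl) ⟨
      sumPowers (map val (class (x ∷ xs) b))                               ∎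
      where open ≡-Reasoning
    ... | no base≢b = begin
      multiplicity b (expand x ++ concatMap expand xs)                     ≡⟨ multiplicity-++ b (expand x) _ ⟩
      multiplicity b (expand x) + multiplicity b (concatMap expand xs)     ≡⟨ cong₂ _+_ (multiplicity-replicate-≢ (k ^ val x) base≢b) (multiplicity-concatMap-expand b xs) ⟩
      sumPowers (map val (class xs b))                                     ≡⟨ cong (sumPowers ∘ map val) (filter-reject (λ x → base x ≟ b) {x} {xs} base≢b) ⟨
      sumPowers (map val (class (x ∷ xs) b))                               ∎
      where open ≡-Reasoning

    class-base : ∀ μ b → All (λ c → base c ≡ b) (class μ b)
    class-base μ b = All.tabulate (proj₂ ∘ ∈-filter⁻ (λ x → base x ≟ b) {xs = μ})

    ≡-map-*k^-val : ∀ {b cs} → All (λ c → base c ≡ b) cs → cs ≡ map (λ t → b * k ^ t) (map val cs)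
    ≡-map-*k^-val []                       = refl
    ≡-map-*k^-val {cs = c ∷ _} (base≡b ∷ rest) =
      cong₂ _∷_ (trans (sym (base-*-k^val c)) (cong (λ b → b * k ^ val c) base≡b)) (≡-map-*k^-val rest)

    multiplicity-val-class<k : ∀ {μ b} → 0 < b → ¬ k ∣ b → (∀ p → multiplicity p μ < k) →
      ∀ t → multiplicity t (map val (class μ b)) < k
    multiplicity-val-class<k {μ} {b} b>0 k∤b μ<k t = begin-strict
      multiplicity t ts              ≡⟨ multiplicity-map-injective h (λ eq → proj₂ (*k^-injective b>0 k∤b b>0 k∤b eq)) t ts ⟨
      multiplicity (h t) (map h ts)  ≡⟨ cong (multiplicity (h t)) (≡-map-*k^-val (class-base μ b)) ⟨
      multiplicity (h t) (class μ b) ≤⟨ multiplicity-filter-≤ (λ x → base x ≟ b) (h t) μ ⟩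
      multiplicity (h t) μ           <⟨ μ<k (h t) ⟩
      k                              ∎
      where
      open ≤-Reasoning
      h : ℕ → ℕ
      h t = b * k ^ t
      ts = map val (class μ b)

    class-↭-digitParts : ∀ {μ b} → 0 < b → ¬ k ∣ b → (∀ p → multiplicity p μ < k) →
      class μ b ↭ digitParts b (multiplicity b (concatMap expand μ))
    class-↭-digitParts {μ} {b} b>0 k∤b μ<k = begin
      class μ b                                 ≡⟨ ≡-map-*k^-val (class-base μ b) ⟩
      map h ts                                  ↭⟨ map-↭ h digits ⟨
      map h (digitExponents f 0 f)              ≡⟨ cong (λ f → digitParts b f) (multiplicity-concatMap-expand b μ) ⟨
      digitParts b (multiplicity b (concatMap expand μ)) ∎
      where
      open PermutationReasoning
      h : ℕ → ℕ
      h t = b * k ^ t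
      ts = map val (class μ b)
      f = sumPowers ts
      digits : digitExponents f 0 f ↭ ts
      digits = ↭-trans (digitExponents-sumPowers f 0 ts (multiplicity-val-class<k {μ} {b} b>0 k∤b μ<k) ≤-refl)
        (↭-reflexive (map-id ts))

    toD-unique : ∀ {n xs μ} → InO k n xs → InD k n μ → expandAll μ ≡ xs → μ ≡ toD xs
    toD-unique {xs = xs} {μ} ((_ , xs>0 , _) , k∤xs) ((μ↘ , _ , _) , μ<k) expandAll-μ≡xs =
      nonincreasing-↭⇒≡ μ↘ (sort-↗ (toD′ xs)) (begin
        μ                                      ↭⟨ Fibres.↭-concatMap-fibre base _≟_ μ (distinct xs) (distinct-unique xs) base∈ ⟩
        concatMap (class μ) (distinct xs)      ↭⟨ concatMap-↭-pointwise _ _ (distinct xs) class↭ ⟩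
        toD′ xs                                ↭⟨ sort-↭ (toD′ xs) ⟨
        toD xs                                 ∎)
      where
      open PermutationReasoning
      base∈ : ∀ {x} → x ∈ μ → base x ∈ distinct xs
      base∈ x∈ = ∈-deduplicate⁺ _≟_ (subst (_ ∈_) expandAll-μ≡xs (∈-expandAll⁺ x∈))
      multiplicity-expand : ∀ b → multiplicity b (concatMap expand μ) ≡ multiplicity b xs
      multiplicity-expand b = trans (sym (multiplicity-↭ b (sort-↭ (concatMap expand μ)))) (cong (multiplicity b) expandAll-μ≡xs)
      class↭ : ∀ {b} → b ∈ distinct xs → class μ b ↭ digitParts b (multiplicity b xs)
      class↭ {b} b∈ = let b∈xs = ∈-deduplicate⁻ _≟_ xs b∈ in
        subst (λ f → class μ b ↭ digitParts b f) (multiplicity-expand b)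
          (class-↭-digitParts {μ} (All.lookup xs>0 b∈xs) (All.lookup k∤xs b∈xs) μ<k)

    -- The partitions in 𝒪_{1,k}(n) that expand to a given partition in 𝒪_k(n)

    record MergeChoice (xs : List ℕ) (b a j : ℕ) : Set where
      field
        b∈xs : b ∈ xs
        a≥1  : 1 ≤ a
        j≥1  : 1 ≤ j
        fits : j * k ^ a ≤ multiplicity b xs

    mergeChoices : List ℕ → List (ℕ × ℕ × ℕ)
    mergeChoices xs = Σ-list (λ b → merges (multiplicity b xs) 1 (multiplicity b xs)) (distinct xs)

    ∈-mergeChoices⁻ : ∀ xs {b a j} → (b , a , j) ∈ mergeChoices xs → MergeChoice xs b a j
    ∈-mergeChoices⁻ xs {b} p∈ with ∈-Σ-list⁻ (λ b → merges (multiplicity b xs) 1 (multiplicity b xs)) (distinct xs) p∈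
    ... | b∈ , aj∈ with ∈-merges⁻ (multiplicity b xs) 1 (multiplicity b xs) aj∈
    ...   | s , refl , j≥1 , fits = record { b∈xs = ∈-deduplicate⁻ _≟_ xs b∈ ; a≥1 = s≤s z≤n ; j≥1 = j≥1 ; fits = fits }

    ∈-mergeChoices⁺ : ∀ {xs b a j} → MergeChoice xs b a j → (b , a , j) ∈ mergeChoices xs
    ∈-mergeChoices⁺ {xs} {b} {suc s} c = ∈-Σ-list⁺ (λ b → merges (multiplicity b xs) 1 (multiplicity b xs))
      (∈-deduplicate⁺ _≟_ b∈xs) (∈-merges⁺ (multiplicity b xs) 1 (multiplicity b xs) s j≥1 fits ≤-refl)
      where open MergeChoice c

    mergeChoices-unique : ∀ xs → Unique (mergeChoices xs)
    mergeChoices-unique xs = Σ-list-unique _ (distinct xs) (distinct-unique xs)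
      (λ {b} _ → merges-unique (multiplicity b xs) 1 (multiplicity b xs))

    mergeList : List ℕ → ℕ → ℕ → ℕ → List ℕ
    mergeList xs b a j = replicate j (b * k ^ a) ++ replicate (multiplicity b xs ∸ j * k ^ a) b ++ removeAll b xs

    merge : List ℕ → ℕ × ℕ × ℕ → List ℕ
    merge xs (b , a , j) = sort (mergeList xs b a j)

    o1Fibre : List ℕ → List (List ℕ)
    o1Fibre xs = map (merge xs) (mergeChoices xs)

    module Merge {n xs} (O : InO k n xs) {b a j} (c : MergeChoice xs b a j) where
      open MergeChoice c

      private
        xs>0 : All (0 <_) xs
        xs>0 = proj₁ (proj₂ (proj₁ O))
        k∤xs : All (λ x → ¬ k ∣ x) xs
        k∤xs = proj₂ O
        others : List ℕ
        others = replicate (multiplicity b xs ∸ j * k ^ a) b ++ removeAll b xs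

      b>0 : 0 < b
      b>0 = All.lookup xs>0 b∈xs

      k∤b : ¬ k ∣ b
      k∤b = All.lookup k∤xs b∈xs

      d : ℕ
      d = b * k ^ a

      k∣d : k ∣ d
      k∣d = ∣*k^ b a≥1

      ∈-others⁻ : ∀ {p} → p ∈ others → p ≡ b ⊎ p ∈ xs
      ∈-others⁻ p∈ with ∈-++⁻ (replicate (multiplicity b xs ∸ j * k ^ a) b) p∈
      ... | inj₁ p∈bs   = inj₁ (∈-replicate⁻ _ p∈bs)
      ... | inj₂ p∈rest = inj₂ (proj₁ (∈-removeAll⁻ b xs p∈rest))

      others>0 : All (0 <_) others
      others>0 = All.tabulate λ p∈ → [ (λ { refl → b>0 }) , All.lookup xs>0 ]′ (∈-others⁻ p∈)

      k∤others : All (λ p → ¬ k ∣ p) others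
      k∤others = All.tabulate λ p∈ → [ (λ { refl → k∤b }) , All.lookup k∤xs ]′ (∈-others⁻ p∈)

      ∈-merge⁻ : ∀ {p} → p ∈ merge xs (b , a , j) → p ≡ d ⊎ p ∈ others
      ∈-merge⁻ p∈ with ∈-++⁻ (replicate j d) (∈-resp-↭ (sort-↭ (mergeList xs b a j)) p∈)
      ... | inj₁ p∈ds     = inj₁ (∈-replicate⁻ j p∈ds)
      ... | inj₂ p∈others = inj₂ p∈others

      ∣-merge⇒≡d : ∀ {p} → p ∈ merge xs (b , a , j) → k ∣ p → p ≡ d
      ∣-merge⇒≡d p∈ k∣p with ∈-merge⁻ p∈
      ... | inj₁ p≡d      = p≡d
      ... | inj₂ p∈others = ⊥-elim (All.lookup k∤others p∈others k∣p)

      d∈merge : d ∈ merge xs (b , a , j)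
      d∈merge = ∈-resp-↭ (↭-sym (sort-↭ (mergeList xs b a j))) (∈-++⁺ˡ (∈-replicate⁺ j j≥1))

      multiplicity-d-merge : multiplicity d (merge xs (b , a , j)) ≡ j
      multiplicity-d-merge = begin
        multiplicity d (merge xs (b , a , j))                        ≡⟨ multiplicity-↭ d (sort-↭ (mergeList xs b a j)) ⟩
        multiplicity d (replicate j d ++ others)                     ≡⟨ multiplicity-++ d (replicate j d) others ⟩
        multiplicity d (replicate j d) + multiplicity d others       ≡⟨ cong₂ _+_ (multiplicity-replicate-≡ d j) (∉⇒multiplicity≡0 d∉others) ⟩
        j + 0                                                        ≡⟨ +-identityʳ j ⟩
        j                                                            ∎
        where
        open ≡-Reasoning
        d∉others : d ∉ others
        d∉others d∈ = All.lookup k∤others d∈ k∣d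

      concatMap-expand-mergeList : concatMap expand (mergeList xs b a j) ↭ xs
      concatMap-expand-mergeList = begin
        concatMap expand (replicate j d ++ others)
          ≡⟨ concatMap-++ expand (replicate j d) others ⟩
        concatMap expand (replicate j d) ++ concatMap expand others
          ≡⟨ cong₂ _++_ (concatMap-expand-replicate b>0 k∤b a j) (concatMap-expand-∤ others>0 k∤others) ⟩
        replicate (j * k ^ a) b ++ replicate (multiplicity b xs ∸ j * k ^ a) b ++ removeAll b xs
          ≡⟨ ++-assoc (replicate (j * k ^ a) b) _ _ ⟨
        (replicate (j * k ^ a) b ++ replicate (multiplicity b xs ∸ j * k ^ a) b) ++ removeAll b xs
          ≡⟨ cong (_++ removeAll b xs) (trans (replicate-++ (j * k ^ a) _ b) (cong (λ m → replicate m b) (m+[n∸m]≡n fits))) ⟩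
        replicate (multiplicity b xs) b ++ removeAll b xs
          ↭⟨ ↭-replicate-++-removeAll b xs ⟨
        xs ∎
        where open PermutationReasoning

      expandAll-merge : expandAll (merge xs (b , a , j)) ≡ xs
      expandAll-merge = expandAll-≡ (merge xs (b , a , j)) (proj₁ (proj₁ O))
        (↭-trans (concatMap-↭ expand (sort-↭ (mergeList xs b a j))) concatMap-expand-mergeList)

      merge-InO1 : InO1 k n (merge xs (b , a , j))
      merge-InO1 =
        (sort-↗ (mergeList xs b a j) , All.tabulate p>0 , Σ-merge) , d , k∣d , d∈merge , λ _ → ∣-merge⇒≡d
        where
        p>0 : ∀ {p} → p ∈ merge xs (b , a , j) → 0 < p
        p>0 p∈ = [ (λ { refl → *k^>0 a b>0 }) , All.lookup others>0 ]′ (∈-merge⁻ p∈)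
        Σ-merge : sum (merge xs (b , a , j)) ≡ n
        Σ-merge = trans (sym (sum-expandAll (merge xs (b , a , j)))) (trans (cong sum expandAll-merge) (proj₂ (proj₂ (proj₁ O))))

    o1Fibre-sound : ∀ {n xs ν} → InO k n xs → ν ∈ o1Fibre xs → InO1 k n ν × expandAll ν ≡ xs
    o1Fibre-sound {xs = xs} O ν∈ with ∈-map⁻ (merge xs) ν∈
    ... | (b , a , j) , c∈ , refl = M.merge-InO1 , M.expandAll-merge
      where module M = Merge O (∈-mergeChoices⁻ xs c∈)

    o1Fibre-unique : ∀ {n xs} → InO k n xs → Unique (o1Fibre xs)
    o1Fibre-unique {xs = xs} O = Unique-map⁺-on (merge xs) (mergeChoices-unique xs) merge-injective
      where
      merge-injective : ∀ {c c′} → c ∈ mergeChoices xs → c′ ∈ mergeChoices xs → merge xs c ≡ merge xs c′ → c ≡ c′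
      merge-injective {b , a , j} {b′ , a′ , j′} c∈ c′∈ eq =
        cong₂ _,_ (proj₁ b,a≡b′,a′) (cong₂ _,_ (proj₂ b,a≡b′,a′) j≡j′)
        where
        module M  = Merge O (∈-mergeChoices⁻ xs c∈)
        module M′ = Merge O (∈-mergeChoices⁻ xs c′∈)
        d≡d′ : M.d ≡ M′.d
        d≡d′ = M′.∣-merge⇒≡d (subst (M.d ∈_) eq M.d∈merge) M.k∣d
        b,a≡b′,a′ : b ≡ b′ × a ≡ a′
        b,a≡b′,a′ = *k^-injective M.b>0 M.k∤b M′.b>0 M′.k∤b d≡d′
        j≡j′ : j ≡ j′
        j≡j′ = begin
          j                                          ≡⟨ M.multiplicity-d-merge ⟨
          multiplicity M.d (merge xs (b , a , j))    ≡⟨ cong₂ multiplicity d≡d′ eq ⟩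
          multiplicity M′.d (merge xs (b′ , a′ , j′)) ≡⟨ M′.multiplicity-d-merge ⟩
          j′                                         ∎
          where open ≡-Reasoning

    k∣⇒val≥1 : ∀ {c} → 0 < c → k ∣ c → 1 ≤ val c
    k∣⇒val≥1 {c} c>0 k∣c with val c in val≡
    ... | suc _ = s≤s z≤n
    ... | zero  = ⊥-elim (∤-base c>0 (subst (k ∣_) c≡base k∣c))
      where
      c≡base : c ≡ base c
      c≡base = trans (sym (base-*-k^val c)) (trans (cong (λ i → base c * k ^ i) val≡) (*-identityʳ (base c)))

    module Unmerge {n xs ν} (O : InO k n xs) (O1 : InO1 k n ν) (expandAll-ν≡xs : expandAll ν ≡ xs) where
      private
        ν>0 : All (0 <_) ν
        ν>0 = proj₁ (proj₂ (proj₁ O1))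
        d : ℕ
        d = proj₁ (proj₂ O1)
        k∣d : k ∣ d
        k∣d = proj₁ (proj₂ (proj₂ O1))
        d∈ν : d ∈ ν
        d∈ν = proj₁ (proj₂ (proj₂ (proj₂ O1)))
        only-d : ∀ p → p ∈ ν → k ∣ p → p ≡ d
        only-d = proj₂ (proj₂ (proj₂ (proj₂ O1)))
        d>0 : 0 < d
        d>0 = All.lookup ν>0 d∈ν
        rest : List ℕ
        rest = removeAll d ν

      b a j : ℕ
      b = base d
      a = val d
      j = multiplicity d ν

      k∤rest : All (λ p → ¬ k ∣ p) rest
      k∤rest = All.tabulate λ p∈ k∣p → let p∈ν , p≢d = ∈-removeAll⁻ d ν p∈ in p≢d (only-d _ p∈ν k∣p)

      xs↭ : xs ↭ replicate (j * k ^ a) b ++ rest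
      xs↭ = begin
        xs                                                    ≡⟨ expandAll-ν≡xs ⟨
        expandAll ν                                           ↭⟨ sort-↭ (concatMap expand ν) ⟩
        concatMap expand ν                                    ↭⟨ concatMap-↭ expand (↭-replicate-++-removeAll d ν) ⟩
        concatMap expand (replicate j d ++ rest)              ≡⟨ concatMap-++ expand (replicate j d) rest ⟩
        concatMap expand (replicate j d) ++ concatMap expand rest
          ≡⟨ cong₂ _++_ (cong (concatMap expand ∘ replicate j) (sym (base-*-k^val d))) rest-expand ⟩
        concatMap expand (replicate j (b * k ^ a)) ++ rest    ≡⟨ cong (_++ rest) (concatMap-expand-replicate (base>0 d>0) (∤-base d>0) a j) ⟩
        replicate (j * k ^ a) b ++ rest                       ∎
        where
        open PermutationReasoning
        rest-expand : concatMap expand rest ≡ rest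
        rest-expand = concatMap-expand-∤ (All.tabulate (All.lookup ν>0 ∘ proj₁ ∘ ∈-removeAll⁻ d ν)) k∤rest

      multiplicity-b : multiplicity b xs ≡ j * k ^ a + multiplicity b rest
      multiplicity-b = trans (multiplicity-↭ b xs↭)
        (trans (multiplicity-++ b (replicate (j * k ^ a) b) rest) (cong (_+ multiplicity b rest) (multiplicity-replicate-≡ b _)))

      choice : MergeChoice xs b a j
      choice = record
        { b∈xs = subst (b ∈_) expandAll-ν≡xs (∈-expandAll⁺ d∈ν)
        ; a≥1  = k∣⇒val≥1 d>0 k∣d
        ; j≥1  = ∈⇒multiplicity>0 d∈ν
        ; fits = subst (j * k ^ a ≤_) (sym multiplicity-b) (m≤m+n _ _)
        }

      merge≡ν : merge xs (b , a , j) ≡ ν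
      merge≡ν = nonincreasing-↭⇒≡ (sort-↗ (mergeList xs b a j)) (proj₁ (proj₁ O1)) (begin
        merge xs (b , a , j)                                              ↭⟨ sort-↭ (mergeList xs b a j) ⟩
        replicate j (b * k ^ a) ++ replicate (multiplicity b xs ∸ j * k ^ a) b ++ removeAll b xs
          ≡⟨ cong₂ (λ p m → replicate j p ++ replicate m b ++ removeAll b xs) (base-*-k^val d)
                   (trans (cong (_∸ j * k ^ a) multiplicity-b) (m+n∸m≡n (j * k ^ a) _)) ⟩
        replicate j d ++ replicate (multiplicity b rest) b ++ removeAll b xs
          ↭⟨ ++⁺ˡ (replicate j d) (++⁺ˡ (replicate (multiplicity b rest) b) removeAll-b-xs) ⟩
        replicate j d ++ replicate (multiplicity b rest) b ++ removeAll b rest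
          ↭⟨ ++⁺ˡ (replicate j d) (↭-replicate-++-removeAll b rest) ⟨
        replicate j d ++ rest                                             ↭⟨ ↭-replicate-++-removeAll d ν ⟨
        ν                                                                 ∎)
        where
        open PermutationReasoning
        removeAll-b-xs : removeAll b xs ↭ removeAll b rest
        removeAll-b-xs = ↭-trans (filter-↭ (λ x → ¬? (x ≟ b)) xs↭) (↭-reflexive (removeAll-replicate-++ b (j * k ^ a) rest))

    o1Fibre-complete : ∀ {n xs ν} → InO k n xs → InO1 k n ν → expandAll ν ≡ xs → ν ∈ o1Fibre xs
    o1Fibre-complete {xs = xs} O O1 eq =
      subst (_∈ o1Fibre xs) U.merge≡ν (∈-map⁺ (merge xs) (∈-mergeChoices⁺ U.choice))
      where module U = Unmerge O O1 eq

    length-toD+o1Fibre : ∀ xs → length xs ≡ length (toD xs) + suc k′ * length (o1Fibre xs)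
    length-toD+o1Fibre xs = begin
      length xs                                                    ≡⟨ ↭-length (↭-concatMap-replicate-multiplicity xs) ⟩
      length (concatMap (λ b → replicate (m b) b) (distinct xs))   ≡⟨ length-concatMap _ (distinct xs) ⟩
      sum (map (λ b → length (replicate (m b) b)) (distinct xs))   ≡⟨ cong sum (map-cong (λ b → length-replicate (m b)) (distinct xs)) ⟩
      sum (map m (distinct xs))                                    ≡⟨ cong sum (map-cong (λ b → length-digitExponents+merges (m b) 0 1 (m b) ≤-refl) (distinct xs)) ⟨
      sum (map (λ b → D b + suc k′ * M b) (distinct xs))           ≡⟨ sum-map-+ D (λ b → suc k′ * M b) (distinct xs) ⟩
      sum (map D (distinct xs)) + sum (map (λ b → suc k′ * M b) (distinct xs))
                                                                   ≡⟨ cong (sum (map D (distinct xs)) +_) (sum-map-*ˡ (suc k′) M (distinct xs)) ⟩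
      sum (map D (distinct xs)) + suc k′ * sum (map M (distinct xs))
                                                                   ≡⟨ cong₂ (λ x y → x + suc k′ * y) length-toD length-o1Fibre ⟨
      length (toD xs) + suc k′ * length (o1Fibre xs)               ∎
      where
      open ≡-Reasoning
      m D M : ℕ → ℕ
      m b = multiplicity b xs
      D b = length (digitExponents (m b) 0 (m b))
      M b = length (merges (m b) 1 (m b))
      length-toD : length (toD xs) ≡ sum (map D (distinct xs))
      length-toD = trans (↭-length (sort-↭ (toD′ xs))) (trans (length-concatMap _ (distinct xs))
        (cong sum (map-cong (λ b → length-map (λ t → b * k ^ t) (digitExponents (m b) 0 (m b))) (distinct xs))))
      length-o1Fibre : length (o1Fibre xs) ≡ sum (map M (distinct xs))
      length-o1Fibre = trans (length-map (merge xs) (mergeChoices xs)) (trans (length-concatMap _ (distinct xs))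
        (cong sum (map-cong (λ b → length-map (b ,_) (merges (m b) 1 (m b))) (distinct xs))))

    module Enumerated {n LO LD LO1} (EO : Enumerates LO (InO k n)) (ED : Enumerates LD (InD k n))
                      (E1 : Enumerates LO1 (InO1 k n)) where
      open Fibres expandAll (≡-dec _≟_)

      private
        inO : ∀ {xs} → xs ∈ LO → InO k n xs
        inO = Equivalence.to (proj₂ EO _)
        inD : ∀ {xs} → xs ∈ LD → InD k n xs
        inD = Equivalence.to (proj₂ ED _)
        inO1 : ∀ {xs} → xs ∈ LO1 → InO1 k n xs
        inO1 = Equivalence.to (proj₂ E1 _)
        expandAll∈LO : ∀ {xs} → IsPartition n xs → expandAll xs ∈ LO
        expandAll∈LO = Equivalence.from (proj₂ EO _) ∘ expandAll-InO
        ∈-fibre⁻ : ∀ {L r x} → x ∈ fibre L r → x ∈ L × expandAll x ≡ r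
        ∈-fibre⁻ {L} = ∈-filter⁻ (λ x → ≡-dec _≟_ (expandAll x) _) {xs = L}
        ∈-fibre⁺ : ∀ {L r x} → x ∈ L → expandAll x ≡ r → x ∈ fibre L r
        ∈-fibre⁺ = ∈-filter⁺ (λ x → ≡-dec _≟_ (expandAll x) _)

      fibre-LD : ∀ {r} → r ∈ LO → fibre LD r ↭ [ toD r ]
      fibre-LD {r} r∈ = unique-same-members⇒↭ (Unique.filter⁺ _ (proj₁ ED)) ([] ∷ [])
        (λ x∈ → let x∈LD , expandAll-x≡r = ∈-fibre⁻ x∈ in here (toD-unique (inO r∈) (inD x∈LD) expandAll-x≡r))
        (λ { (here refl) → ∈-fibre⁺ (Equivalence.from (proj₂ ED _) (toD-InD (inO r∈))) (expandAll-toD (inO r∈)) })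

      fibre-LO1 : ∀ {r} → r ∈ LO → fibre LO1 r ↭ o1Fibre r
      fibre-LO1 {r} r∈ = unique-same-members⇒↭ (Unique.filter⁺ _ (proj₁ E1)) (o1Fibre-unique (inO r∈))
        (λ x∈ → let x∈LO1 , expandAll-x≡r = ∈-fibre⁻ x∈ in o1Fibre-complete (inO r∈) (inO1 x∈LO1) expandAll-x≡r)
        (λ x∈ → let O1 , expandAll-x≡r = o1Fibre-sound (inO r∈) x∈ in
          ∈-fibre⁺ (Equivalence.from (proj₂ E1 _) O1) expandAll-x≡r)

      sum-length-LD : sum (map length LD) ≡ sum (map (length ∘ toD) LO)
      sum-length-LD = trans (sum-map-fibres length LD LO (proj₁ EO) (expandAll∈LO ∘ proj₁ ∘ inD))
        (sum-map-cong-∈ _ _ LO λ r∈ → trans (sum-map-↭ length (fibre-LD r∈)) (+-identityʳ _))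

      length-LO1 : length LO1 ≡ sum (map (length ∘ o1Fibre) LO)
      length-LO1 = trans (length-fibres LO1 LO (proj₁ EO) (expandAll∈LO ∘ proj₁ ∘ inO1))
        (sum-map-cong-∈ _ _ LO (↭-length ∘ fibre-LO1))

      sum-length-LO : sum (map length LO) ≡ sum (map length LD) + suc k′ * length LO1
      sum-length-LO = begin
        sum (map length LO)                                          ≡⟨ sum-map-cong-∈ _ _ LO (λ {xs} _ → length-toD+o1Fibre xs) ⟩
        sum (map (λ xs → length (toD xs) + suc k′ * length (o1Fibre xs)) LO)
                                                                     ≡⟨ sum-map-+ _ _ LO ⟩
        sum (map (length ∘ toD) LO) + sum (map (λ xs → suc k′ * length (o1Fibre xs)) LO)
                                                                     ≡⟨ cong₂ _+_ sum-length-LD (trans (cong (suc k′ *_) length-LO1) (sym (sum-map-*ˡ (suc k′) _ LO))) ⟨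
        sum (map length LD) + suc k′ * length LO1                    ∎
        where open ≡-Reasoning

open import Defs
open import Data.Nat using (ℕ; _≤_; _∸_; suc; s≤s; z≤n)
open import Data.Nat.Properties using (m+n∸m≡n; m≤m+n)
open import Data.Integer using (+_; _*_; _-_; _⊖_)
open import Data.Integer.Properties using (pos-*; ⊖-≥; m-n≡m⊖n)
open import Data.List using (List; length; map)
open import Data.Nat.ListAction using (sum)
open import Relation.Binary.PropositionalEquality using (_≡_; cong; sym; module ≡-Reasoning)

import Data.Nat as ℕ

+[m+n]-+m : ∀ m n → + (m ℕ.+ n) - + m ≡ + n
+[m+n]-+m m n = begin
  + (m ℕ.+ n) - + m     ≡⟨ m-n≡m⊖n (m ℕ.+ n) m ⟩
  (m ℕ.+ n) ⊖ m         ≡⟨ ⊖-≥ (m≤m+n m n) ⟩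
  + (m ℕ.+ n ∸ m)       ≡⟨ cong +_ (m+n∸m≡n m n) ⟩
  + n                   ∎
  where open ≡-Reasoning

theorem1p6 : (k n : ℕ) → 2 ≤ k →
    (LO LD LO1 : List (List ℕ)) →
    Enumerates LO (InO k n) → Enumerates LD (InD k n) → Enumerates LO1 (InO1 k n) →
    (+ (k ∸ 1)) * (+ length LO1) ≡ (+ sum (map length LO)) - (+ sum (map length LD))
theorem1p6 (suc (suc k′)) n (s≤s (s≤s z≤n)) LO LD LO1 EO ED E1 = begin
  + suc k′ * + length LO1                          ≡⟨ pos-* (suc k′) (length LO1) ⟨
  + (suc k′ ℕ.* length LO1)                        ≡⟨ +[m+n]-+m (sum (map length LD)) _ ⟨
  + (sum (map length LD) ℕ.+ suc k′ ℕ.* length LO1) - + sum (map length LD)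
    ≡⟨ cong (λ m → + m - + sum (map length LD)) (sym (Glaisher.Radix.Enumerated.sum-length-LO k′ EO ED E1)) ⟩
  + sum (map length LO) - + sum (map length LD)    ∎
  where open ≡-Reasoning
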